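{- Let $\alpha$ be a composition of $n$, $E\in\mathcal E(\alpha)$ and $T_0=T_{0,E}$ its source tableau. For every $i\in D(T_0)$ there exists an entry $k$ of $T_0$ with $k>i$ such that $i$ attacks $k$ in $T_0$.
   Context: A composition $\alpha=(\alpha_1,\dots,\alpha_l)$ of $n$ has diagram $\{(i,j):i\le l,j\le\alpha_i\}$ (matrix coordinates, row 1 on top). An SCT of shape $\alpha$ is a bijection $T$ from the diagram to $[n]$ with rows decreasing left to right, first column increasing top to bottom, and the triple rule: if $(j,k),(i,k-1)\in\alpha$, $j>i$, $T(j,k)<T(i,k-1)$, then $(i,k)\in\alpha$ and $T(j,k)<T(i,k)$. Let $c_T(k)$ be the column of $T^{ -1}(k)$ and $D(T)=\{i\in[n-1]:c_T(i)\le c_T(i+1)\}$. A cell $(i,j)$ attacks $(i',j')$ if $j=j'$ and $i\ne i'$, or $j=j'-1$ and $i<i'$; entry $a$ attacks $b$ in $T$ if $T^{ -1}(a)$ attacks $T^{ -1}(b)$. $T_1\sim T_2$ iff in each column the relative orders of entries coincide; $\mathcal E(\alpha)$ is the set of equivalence classes. The source tableau $T_{0,E}$ of $E$ is the unique $T\in E$ such that for every $i\in[n-1]\setminus D(T)$ the cell of $i+1$ is immediately to the left of the cell of $i$ in the same row. -}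

module Defs where

open import Data.Nat using (ℕ; zero; suc; _≤_; _<_; _∸_)
open import Data.List using (List; []; _∷_)
open import Data.List.Relation.Unary.All using (All)
open import Data.Product using (Σ; _×_; ∃-syntax)
open import Data.Sum using (_⊎_)
open import Relation.Binary.PropositionalEquality using (_≡_; _≢_)
open import Relation.Nullary using (¬_)
open import Function.Bundles using (_⇔_)

-- A composition: list of positive parts; it is a composition of n iff sum ≡ n.
IsComposition : List ℕ → Set
IsComposition α = All (λ a → 0 < a) α

-- part α i = α_i (1-indexed), 0 outside 1..ℓ(α)
part : List ℕ → ℕ → ℕ
part []      _             = 0
part (a ∷ α) zero          = 0
part (a ∷ α) (suc zero)    = a
part (a ∷ α) (suc (suc i)) = part α (suc i)

-- (i , j) ∈ diagram of α  (matrix coordinates, 1-indexed, row 1 on top)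
InDiag : List ℕ → ℕ → ℕ → Set
InDiag α i j = (1 ≤ i) × (1 ≤ j) × (j ≤ part α i)

-- A filling: value T i j at cell (row i, column j); only values on the diagram matter.
Filling : Set
Filling = ℕ → ℕ → ℕ

CellOf : List ℕ → Filling → ℕ → ℕ → ℕ → Set
CellOf α T a r c = InDiag α r c × T r c ≡ a

record IsSCT (n : ℕ) (α : List ℕ) (T : Filling) : Set where
  field
    range     : ∀ i j → InDiag α i j → (1 ≤ T i j) × (T i j ≤ n)
    injective : ∀ i j i' j' → InDiag α i j → InDiag α i' j' →
                T i j ≡ T i' j' → (i ≡ i') × (j ≡ j')
    surjective : ∀ a → 1 ≤ a → a ≤ n → ∃[ i ] ∃[ j ] CellOf α T a i j
    rowsDec   : ∀ i j → InDiag α i j → InDiag α i (suc j) → T i (suc j) < T i j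
    col1Inc   : ∀ i → InDiag α i 1 → InDiag α (suc i) 1 → T i 1 < T (suc i) 1
    -- triple rule, with k = suc k' (so k-1 = k'), k' ≥ 1
    triple    : ∀ i j k' → 1 ≤ k' → InDiag α j (suc k') → InDiag α i k' → i < j →
                T j (suc k') < T i k' →
                InDiag α i (suc k') × (T j (suc k') < T i (suc k'))

InDescent : ℕ → List ℕ → Filling → ℕ → Set
InDescent n α T i =
  (1 ≤ i) × (suc i ≤ n) ×
  (∀ r c r' c' → CellOf α T i r c → CellOf α T (suc i) r' c' → c ≤ c')

CellAttacks : ℕ → ℕ → ℕ → ℕ → Set
CellAttacks i j i' j' = ((j ≡ j') × (i ≢ i')) ⊎ ((suc j ≡ j') × (i < i'))

Attacks : List ℕ → Filling → ℕ → ℕ → Set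
Attacks α T a b = ∃[ r ] ∃[ c ] ∃[ r' ] ∃[ c' ]
  (CellOf α T a r c × CellOf α T b r' c' × CellAttacks r c r' c')

Equiv : List ℕ → Filling → Filling → Set
Equiv α T₁ T₂ = ∀ i i' j → InDiag α i j → InDiag α i' j →
  (T₁ i j < T₁ i' j ⇔ T₂ i j < T₂ i' j)

IsSourceCond : ℕ → List ℕ → Filling → Set
IsSourceCond n α T = ∀ i → 1 ≤ i → suc i ≤ n → ¬ InDescent n α T i →
  ∀ r c → CellOf α T i r c → Σ ℕ (λ c' → (c ≡ suc c') × CellOf α T (suc i) r c')

-- Let i sit in column c and i+1 in column c' ≥ c. If c' = c, then i attacks i+1 in its column.
-- If c' > c, the row of i+1 also has a cell in column c, and since rows decrease its entry
-- exceeds i+1 > i; it is a different entry of i's column, so i attacks it.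
module Submission where

open import Defs
open import Data.Nat using (ℕ; _<_; _≤_; suc; s≤s; z≤n)
open import Data.Nat.Properties
  using (≤-trans; <-trans; <⇒≤; <⇒≢; n≤1+n; n<1+n; m≤n⇒m<n∨m≡n)
open import Data.List using (List)
open import Data.Nat.ListAction using (sum)
open import Data.Product using (_×_; ∃-syntax; _,_)
open import Data.Sum using (inj₁; inj₂)
open import Relation.Binary.PropositionalEquality
  using (_≡_; _≢_; refl; sym; trans; subst)

RowsDecreasing : List ℕ → Filling → Set
RowsDecreasing α T = ∀ i j → InDiag α i j → InDiag α i (suc j) → T i (suc j) < T i j

InDiag-leftClosed : ∀ α {r j j'} → 1 ≤ j → j ≤ j' → InDiag α r j' → InDiag α r j
InDiag-leftClosed _ 1≤j j≤j' (1≤r , _ , j'≤part) = 1≤r , 1≤j , ≤-trans j≤j' j'≤part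

rowsDecreasing⇒rowStrictlyAnti : ∀ α {T} → RowsDecreasing α T →
  ∀ r {j j'} → j < j' → InDiag α r j → InDiag α r j' → T r j' < T r j
rowsDecreasing⇒rowStrictlyAnti α rowsDec r {j} {suc j''} (s≤s j≤j'') dj@(_ , 1≤j , _) dj'
  with m≤n⇒m<n∨m≡n j≤j''
... | inj₂ refl = rowsDec r j dj dj'
... | inj₁ j<j'' =
  <-trans (rowsDec r j'' dj'' dj') (rowsDecreasing⇒rowStrictlyAnti α rowsDec r j<j'' dj dj'')
  where
    dj'' : InDiag α r j''
    dj'' = InDiag-leftClosed α (≤-trans 1≤j j≤j'') (n≤1+n j'') dj'

sameColumn⇒attacks : ∀ α {T a b r r' c} → a ≢ b →
  CellOf α T a r c → CellOf α T b r' c → Attacks α T a b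
sameColumn⇒attacks _ {r = r} {r'} {c} a≢b cellA@(_ , Ta) cellB@(_ , Tb) =
  r , c , r' , c , cellA , cellB , inj₁ (refl , r≢r')
  where
    r≢r' : r ≢ r'
    r≢r' refl = a≢b (trans (sym Ta) Tb)

successorWeaklyRight⇒attacksLarger : ∀ α {T i r c r' c'} → RowsDecreasing α T →
  CellOf α T i r c → CellOf α T (suc i) r' c' → c ≤ c' →
  ∃[ k ] ((i < k) × Attacks α T i k)
successorWeaklyRight⇒attacksLarger α {i = i} rowsDec cellI cellSi c≤c'
  with m≤n⇒m<n∨m≡n c≤c'
... | inj₂ refl = suc i , n<1+n i , sameColumn⇒attacks α (<⇒≢ (n<1+n i)) cellI cellSi
successorWeaklyRight⇒attacksLarger α {T} {i} {r} {c} {r'} rowsDec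
  cellI@((_ , 1≤c , _) , _) (dr' , Tr'c'≡si) _ | inj₁ c<c' =
    T r' c , i<k , sameColumn⇒attacks α (<⇒≢ i<k) cellI (dr'c , refl)
  where
    dr'c : InDiag α r' c
    dr'c = InDiag-leftClosed α 1≤c (<⇒≤ c<c') dr'

    i<k : i < T r' c
    i<k = <-trans (n<1+n i)
      (subst (_< T r' c) Tr'c'≡si (rowsDecreasing⇒rowStrictlyAnti α rowsDec r' c<c' dr'c dr'))

lemma4p4 : (n : ℕ) (α : List ℕ) → IsComposition α → sum α ≡ n →
    (S : Filling) → IsSCT n α S →
    (T₀ : Filling) → IsSCT n α T₀ → Equiv α S T₀ → IsSourceCond n α T₀ →
    ∀ i → InDescent n α T₀ i → ∃[ k ] ((i < k) × Attacks α T₀ i k)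
lemma4p4 n α _ _ S _ T₀ sct _ _ i (1≤i , si≤n , colsWeaklyIncrease)
  with IsSCT.surjective sct i 1≤i (≤-trans (n≤1+n i) si≤n)
     | IsSCT.surjective sct (suc i) (s≤s z≤n) si≤n
... | r , c , cellI | r' , c' , cellSi =
  successorWeaklyRight⇒attacksLarger α (IsSCT.rowsDec sct) cellI cellSi
    (colsWeaklyIncrease r c r' c' cellI cellSi)
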